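{- Let $\lambda_1,\lambda_2\in \mathbb{N}$ be two coprime positive integers such that $\lambda_1 \equiv \lambda_2 \pmod 3$, and let $S=\{0,\lambda_1,\lambda_1+\lambda_2\}$. Then $d_f(S,-S) = d_f(S) = \frac{2}{3}$.
   Context: For $A\subset\mathbb{Z}$, the upper density is $\overline{d}(A)=\limsup_{n\to\infty}\frac{|A\cap[-n,n]|}{2n+1}$. For $S\subset\mathbb{Z}$, a translate of $S$ is a set $S+t=\{s+t:s\in S\}$ with $t\in\mathbb{Z}$, and $-S=\{ -s:s\in S\}$. A set $A\subset\mathbb{Z}$ is $S$-free if it contains no translate of $S$. $d_f(S)$ is the supremum of $\overline{d}(A)$ over all $S$-free sets $A\subset\mathbb{Z}$, and $d_f(S,-S)$ is the supremum of $\overline{d}(A)$ over all sets $A\subset\mathbb{Z}$ that contain no translate of $S$ and no translate of $-S$. -}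

module Defs where

open import Data.Bool using (Bool; true)
open import Data.Nat as ℕ using (ℕ; suc; _%_)
open import Data.Integer as ℤ using (ℤ; +_)
open import Data.Rational as ℚ using (ℚ; 0ℚ)
open import Data.List using (List; []; _∷_; map; upTo; length; filterᵇ)
open import Data.List.Relation.Unary.All using (All)
open import Data.Product using (Σ; ∃; _×_)
open import Relation.Binary.PropositionalEquality using (_≡_)
open import Relation.Nullary using (¬_)

SubsetZ : Set
SubsetZ = ℤ → Bool

window : ℕ → List ℤ
window n = map (λ i → (+ i) ℤ.- (+ n)) (upTo (suc (2 ℕ.* n)))

countIn : SubsetZ → ℕ → ℕ
countIn A n = length (filterᵇ A (window n))

ratio : SubsetZ → ℕ → ℚ
ratio A n = (+ countIn A n) ℚ./ suc (2 ℕ.* n)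

translate : List ℤ → ℤ → List ℤ
translate S t = map (λ s → s ℤ.+ t) S

negS : List ℤ → List ℤ
negS S = map ℤ.-_ S

ContainsTranslate : SubsetZ → List ℤ → Set
ContainsTranslate A S = ∃ λ t → All (λ x → A x ≡ true) (translate S t)

Free : List ℤ → SubsetZ → Set
Free S A = ¬ ContainsTranslate A S

Free₂ : List ℤ → List ℤ → SubsetZ → Set
Free₂ S S' A = Free S A × Free S' A

UpperDensity≤ : SubsetZ → ℚ → Set
UpperDensity≤ A c = ∀ (ε : ℚ) → 0ℚ ℚ.< ε →
  ∃ λ N → ∀ n → N ℕ.≤ n → ratio A n ℚ.≤ c ℚ.+ ε

UpperDensity> : SubsetZ → ℚ → Set
UpperDensity> A c = ∃ λ c' → c ℚ.< c' ×
  (∀ N → ∃ λ n → N ℕ.≤ n × c' ℚ.≤ ratio A n)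

SupDensityIs : (SubsetZ → Set) → ℚ → Set
SupDensityIs P c =
  (∀ A → P A → UpperDensity≤ A c) ×
  (∀ c' → c' ℚ.< c → ∃ λ A → P A × UpperDensity> A c')

DfIs : List ℤ → ℚ → Set
DfIs S c = SupDensityIs (Free S) c

DfSymIs : List ℤ → ℚ → Set
DfSymIs S c = SupDensityIs (Free₂ S (negS S)) c

-- Upper bound: if A avoids every translate of {0, a, a + b}, then for each i at most two of
-- i, a + i, a + b + i lie in A; summing over a window of length m and shifting the second
-- and third sums back costs at most a + (a + b), so 3 |A ∩ window| ≤ 2m + O(1).
-- Lower bound: the non-multiples of 3 have density 2/3, and since λ₁ ≡ λ₂ ≢ 0 (mod 3) the
-- points t, t + λ₁, t + λ₁ + λ₂ run through all three residues, so one of them is a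
-- multiple of 3; the same holds for -S, which is a translate of {0, λ₂, λ₂ + λ₁}.
module Submission where

open import Defs
open import Data.Nat using (ℕ; _<_; _%_; _+_)
open import Data.Nat.Coprimality using (Coprime)
open import Data.Integer using (+_)
open import Data.Rational using (_/_)
open import Data.List using (_∷_; [])
open import Data.Product using (_×_)
open import Relation.Binary.PropositionalEquality using (_≡_)

open import Function using (id; _∘_)
open import Data.Bool using (Bool; true; false; not; _∧_)
open import Data.Nat using (zero; suc; _*_; _∸_; _≤_; _≡ᵇ_; z≤n; s≤s; NonZero)
import Data.Nat.Properties as ℕ
open import Data.Nat.DivMod using (%-distribˡ-+; m%n%n≡m%n; [m+kn]%n≡m%n; m%n<n; n%n≡0)
open import Data.Nat.Divisibility using (m%n≡0⇒n∣m)
open import Data.Nat.Tactic.RingSolver using (solve-∀)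
open import Data.Integer as ℤ using (ℤ; -[1+_])
import Data.Integer.Properties as ℤ
import Data.Integer.Tactic.RingSolver as ℤ-Solver
open import Data.Rational as ℚ using (mkℚ)
import Data.Rational.Properties as ℚ
import Data.Rational.Unnormalised as ℚᵘ
import Data.Rational.Unnormalised.Properties as ℚᵘ
open import Data.List using (List; map; upTo; applyUpTo; length; filterᵇ)
open import Data.List.Properties using (map-upTo)
open import Data.List.Relation.Unary.All using (_∷_; [])
open import Data.Product using (_,_; proj₁; ∃)
open import Data.Empty using (⊥; ⊥-elim)
open import Relation.Binary.PropositionalEquality
  using (_≢_; refl; sym; trans; cong; cong₂; subst; subst₂; module ≡-Reasoning)

indicator : Bool → ℕ
indicator true  = 1
indicator false = 0

indicator≤1 : ∀ b → indicator b ≤ 1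
indicator≤1 true  = s≤s z≤n
indicator≤1 false = z≤n

indicator-triple≤2 : ∀ b₁ b₂ b₃ → (b₁ ≡ true → b₂ ≡ true → b₃ ≡ true → ⊥) →
                     indicator b₁ + indicator b₂ + indicator b₃ ≤ 2
indicator-triple≤2 true  true  true  not-all = ⊥-elim (not-all refl refl refl)
indicator-triple≤2 true  true  false _ = ℕ.≤-refl
indicator-triple≤2 true  false true  _ = ℕ.≤-refl
indicator-triple≤2 true  false false _ = s≤s z≤n
indicator-triple≤2 false true  true  _ = ℕ.≤-refl
indicator-triple≤2 false true  false _ = s≤s z≤n
indicator-triple≤2 false false true  _ = s≤s z≤n
indicator-triple≤2 false false false _ = z≤n

sumUpTo : (ℕ → ℕ) → ℕ → ℕ
sumUpTo f zero    = 0
sumUpTo f (suc m) = f 0 + sumUpTo (f ∘ suc) m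

sumUpTo-cong : ∀ {f g} m → (∀ i → f i ≡ g i) → sumUpTo f m ≡ sumUpTo g m
sumUpTo-cong zero    f≗g = refl
sumUpTo-cong (suc m) f≗g = cong₂ _+_ (f≗g 0) (sumUpTo-cong m (f≗g ∘ suc))

sumUpTo-≤ : ∀ {f} c m → (∀ i → f i ≤ c) → sumUpTo f m ≤ m * c
sumUpTo-≤ c zero    f≤c = z≤n
sumUpTo-≤ c (suc m) f≤c = ℕ.+-mono-≤ (f≤c 0) (sumUpTo-≤ c m (f≤c ∘ suc))

sumUpTo-+ : ∀ f g m → sumUpTo (λ i → f i + g i) m ≡ sumUpTo f m + sumUpTo g m
sumUpTo-+ f g zero    = refl
sumUpTo-+ f g (suc m) = trans (cong (_+_ (f 0 + g 0)) (sumUpTo-+ (f ∘ suc) (g ∘ suc) m))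
                              (interchange (f 0) (g 0) _ _)
  where
  interchange : ∀ w x y z → w + x + (y + z) ≡ w + y + (x + z)
  interchange = solve-∀

sumUpTo-split : ∀ f k m → sumUpTo f (k + m) ≡ sumUpTo f k + sumUpTo (λ i → f (k + i)) m
sumUpTo-split f zero    m = refl
sumUpTo-split f (suc k) m =
  trans (cong (_+_ (f 0)) (sumUpTo-split (f ∘ suc) k m)) (sym (ℕ.+-assoc (f 0) _ _))

sumUpTo-shift-≤ : ∀ f k m → (∀ i → f i ≤ 1) →
                  sumUpTo f m ≤ k + sumUpTo (λ i → f (k + i)) m
sumUpTo-shift-≤ f k m f≤1 = begin
  sumUpTo f m                                 ≤⟨ ℕ.m≤m+n _ _ ⟩
  sumUpTo f m + sumUpTo (λ i → f (m + i)) k   ≡⟨ sumUpTo-split f m k ⟨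
  sumUpTo f (m + k)                           ≡⟨ cong (sumUpTo f) (ℕ.+-comm m k) ⟩
  sumUpTo f (k + m)                           ≡⟨ sumUpTo-split f k m ⟩
  sumUpTo f k + sumUpTo (λ i → f (k + i)) m   ≤⟨ ℕ.+-monoˡ-≤ _ (sumUpTo-≤ 1 k f≤1) ⟩
  k * 1 + Σₖ                                  ≡⟨ cong (_+ Σₖ) (ℕ.*-identityʳ k) ⟩
  k + Σₖ                                      ∎
  where
  open ℕ.≤-Reasoning
  Σₖ = sumUpTo (λ i → f (k + i)) m

sumUpTo-periodic : ∀ f p → (∀ i → f (p + i) ≡ f i) →
                   ∀ k → sumUpTo f (k * p) ≡ k * sumUpTo f p
sumUpTo-periodic f p periodic zero    = refl
sumUpTo-periodic f p periodic (suc k) = begin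
  sumUpTo f (p + k * p)                               ≡⟨ sumUpTo-split f p (k * p) ⟩
  sumUpTo f p + sumUpTo (λ i → f (p + i)) (k * p)     ≡⟨ cong (_+_ (sumUpTo f p))
                                                           (sumUpTo-cong (k * p) periodic) ⟩
  sumUpTo f p + sumUpTo f (k * p)                     ≡⟨ cong (_+_ (sumUpTo f p))
                                                           (sumUpTo-periodic f p periodic k) ⟩
  sumUpTo f p + k * sumUpTo f p                       ∎
  where open ≡-Reasoning

3*sumUpTo-≤ : ∀ f a b m → (∀ i → f i ≤ 1) → (∀ i → f i + f (a + i) + f (b + i) ≤ 2) →
              3 * sumUpTo f m ≤ m * 2 + (a + b)
3*sumUpTo-≤ f a b m f≤1 triples≤2 = begin
  3 * Σ                                   ≡⟨ three-times Σ ⟩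
  Σ + Σ + Σ                               ≤⟨ ℕ.+-mono-≤ (ℕ.+-monoʳ-≤ Σ (sumUpTo-shift-≤ f a m f≤1))
                                                       (sumUpTo-shift-≤ f b m f≤1) ⟩
  Σ + (a + Σᵃ) + (b + Σᵇ)                 ≡⟨ regroup Σ a Σᵃ b Σᵇ ⟩
  Σ + Σᵃ + Σᵇ + (a + b)                   ≡⟨ cong (_+ (a + b)) sum-of-triples ⟨
  sumUpTo triple m + (a + b)              ≤⟨ ℕ.+-monoˡ-≤ (a + b) (sumUpTo-≤ 2 m triples≤2) ⟩
  m * 2 + (a + b)                         ∎
  where
  open ℕ.≤-Reasoning
  Σ   = sumUpTo f m
  Σᵃ  = sumUpTo (λ i → f (a + i)) m
  Σᵇ  = sumUpTo (λ i → f (b + i)) m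
  triple = λ i → f i + f (a + i) + f (b + i)
  three-times : ∀ s → 3 * s ≡ s + s + s
  three-times = solve-∀
  regroup : ∀ s a x b y → s + (a + x) + (b + y) ≡ s + x + y + (a + b)
  regroup = solve-∀
  sum-of-triples : sumUpTo triple m ≡ Σ + Σᵃ + Σᵇ
  sum-of-triples = trans (sumUpTo-+ (λ i → f i + f (a + i)) (λ i → f (b + i)) m)
                         (cong (_+ Σᵇ) (sumUpTo-+ f (λ i → f (a + i)) m))

length-filterᵇ-applyUpTo : ∀ {A : Set} (p : A → Bool) (h : ℕ → A) m →
  length (filterᵇ p (applyUpTo h m)) ≡ sumUpTo (indicator ∘ p ∘ h) m
length-filterᵇ-applyUpTo p h zero = refl
length-filterᵇ-applyUpTo p h (suc m) with p (h 0)
... | true  = cong suc (length-filterᵇ-applyUpTo p (h ∘ suc) m)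
... | false = length-filterᵇ-applyUpTo p (h ∘ suc) m

countIn≡sumUpTo : ∀ A n →
  countIn A n ≡ sumUpTo (λ i → indicator (A (ℤ.- + n ℤ.+ + i))) (suc (2 * n))
countIn≡sumUpTo A n = begin
  length (filterᵇ A (map window-point (upTo (suc (2 * n)))))
    ≡⟨ cong (length ∘ filterᵇ A) (map-upTo window-point (suc (2 * n))) ⟩
  length (filterᵇ A (applyUpTo window-point (suc (2 * n))))
    ≡⟨ length-filterᵇ-applyUpTo A window-point (suc (2 * n)) ⟩
  sumUpTo (indicator ∘ A ∘ window-point) (suc (2 * n))
    ≡⟨ sumUpTo-cong (suc (2 * n)) (λ i → cong (indicator ∘ A) (ℤ.+-comm (+ i) (ℤ.- + n))) ⟩
  sumUpTo (λ i → indicator (A (ℤ.- + n ℤ.+ + i))) (suc (2 * n)) ∎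
  where
  open ≡-Reasoning
  window-point : ℕ → ℤ
  window-point i = + i ℤ.- + n

gapPattern : ℕ → ℕ → List ℤ
gapPattern a b = + 0 ∷ + a ∷ + (a + b) ∷ []

free⇒triple≤2 : ∀ a b A → Free (gapPattern a b) A → ∀ t →
  indicator (A t) + indicator (A (t ℤ.+ + a)) + indicator (A (t ℤ.+ + (a + b))) ≤ 2
free⇒triple≤2 a b A free t = indicator-triple≤2 _ _ _ (λ h₀ h₁ h₂ → free (t ,
  subst (λ x → A x ≡ true) (sym (ℤ.+-identityˡ t)) h₀ ∷
  subst (λ x → A x ≡ true) (ℤ.+-comm t (+ a)) h₁ ∷
  subst (λ x → A x ≡ true) (ℤ.+-comm t (+ (a + b))) h₂ ∷ []))

free⇒3*countIn≤ : ∀ a b A → Free (gapPattern a b) A →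
  ∀ n → 3 * countIn A n ≤ suc (2 * n) * 2 + (a + (a + b))
free⇒3*countIn≤ a b A free n =
  subst (λ c → 3 * c ≤ suc (2 * n) * 2 + (a + (a + b))) (sym (countIn≡sumUpTo A n))
    (3*sumUpTo-≤ f a (a + b) (suc (2 * n)) (λ i → indicator≤1 _) triple≤2)
  where
  f : ℕ → ℕ
  f i = indicator (A (ℤ.- + n ℤ.+ + i))
  shift : ∀ x k i → x ℤ.+ (k ℤ.+ i) ≡ (x ℤ.+ i) ℤ.+ k
  shift = ℤ-Solver.solve-∀
  triple≤2 : ∀ i → f i + f (a + i) + f (a + b + i) ≤ 2
  triple≤2 i rewrite shift (ℤ.- + n) (+ a) (+ i) | shift (ℤ.- + n) (+ (a + b)) (+ i) =
    free⇒triple≤2 a b A free (ℤ.- + n ℤ.+ + i)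

/-mono-cross : ∀ a b c d → a * suc d ≤ c * suc b → + a / suc b ℚ.≤ + c / suc d
/-mono-cross a b c d ad≤cb = ℚ.toℚᵘ-cancel-≤
  (ℚᵘ.≤-respˡ-≃ (ℚᵘ.≃-sym (ℚ.toℚᵘ-fromℚᵘ (ℚᵘ.mkℚᵘ (+ a) b)))
  (ℚᵘ.≤-respʳ-≃ (ℚᵘ.≃-sym (ℚ.toℚᵘ-fromℚᵘ (ℚᵘ.mkℚᵘ (+ c) d)))
  (ℚᵘ.*≤* (subst₂ ℤ._≤_ (ℤ.pos-* a (suc d)) (ℤ.pos-* c (suc b)) (ℤ.+≤+ ad≤cb)))))

-- For ε = (p+1)/(d+1), once 2n+1 > K (d+1) the error K / 3(2n+1) is below ε.
upperDensity≤2/3 : ∀ A K → (∀ n → 3 * countIn A n ≤ suc (2 * n) * 2 + K) →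
                   UpperDensity≤ A (+ 2 / 3)
upperDensity≤2/3 A K bound (mkℚ (+ zero) _ _) (ℚ.*<* (ℤ.+<+ ()))
upperDensity≤2/3 A K bound (mkℚ -[1+ _ ] _ _) (ℚ.*<* ())
upperDensity≤2/3 A K bound (mkℚ (+ suc p) d _) _ = K * suc d , λ n N≤n →
  /-mono-cross (countIn A n) (2 * n) (2 * suc d + suc p * 3) _ (cross n N≤n)
  where
  cross : ∀ n → K * suc d ≤ n →
          countIn A n * (3 * suc d) ≤ (2 * suc d + suc p * 3) * suc (2 * n)
  cross n N≤n = begin
    C * (3 * suc d)                          ≡⟨ reassoc C (suc d) ⟩
    3 * C * suc d                            ≤⟨ ℕ.*-monoˡ-≤ (suc d) (bound n) ⟩
    (m * 2 + K) * suc d                      ≡⟨ distrib m K (suc d) ⟩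
    2 * suc d * m + K * suc d                ≤⟨ ℕ.+-monoʳ-≤ (2 * suc d * m) K[d+1]≤[p+1]3m ⟩
    2 * suc d * m + suc p * 3 * m            ≡⟨ ℕ.*-distribʳ-+ m (2 * suc d) (suc p * 3) ⟨
    (2 * suc d + suc p * 3) * m              ∎
    where
    open ℕ.≤-Reasoning
    C = countIn A n
    m = suc (2 * n)
    reassoc : ∀ c x → c * (3 * x) ≡ 3 * c * x
    reassoc = solve-∀
    distrib : ∀ m K x → (m * 2 + K) * x ≡ 2 * x * m + K * x
    distrib = solve-∀
    K[d+1]≤[p+1]3m : K * suc d ≤ suc p * 3 * m
    K[d+1]≤[p+1]3m = ℕ.≤-trans N≤n
      (ℕ.≤-trans (ℕ.m≤n⇒m≤1+n (ℕ.m≤n*m n 2)) (ℕ.m≤n*m m (suc p * 3)))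

free⇒upperDensity≤2/3 : ∀ a b A → Free (gapPattern a b) A → UpperDensity≤ A (+ 2 / 3)
free⇒upperDensity≤2/3 a b A free =
  upperDensity≤2/3 A (a + (a + b)) (free⇒3*countIn≤ a b A free)

%-resp-+ : ∀ d .{{_ : NonZero d}} m m′ n n′ → m % d ≡ m′ % d → n % d ≡ n′ % d →
           (m + n) % d ≡ (m′ + n′) % d
%-resp-+ d m m′ n n′ m≡m′ n≡n′ = begin
  (m + n) % d                ≡⟨ %-distribˡ-+ m n d ⟩
  (m % d + n % d) % d        ≡⟨ cong₂ (λ x y → (x + y) % d) m≡m′ n≡n′ ⟩
  (m′ % d + n′ % d) % d      ≡⟨ %-distribˡ-+ m′ n′ d ⟨
  (m′ + n′) % d              ∎
  where open ≡-Reasoning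

-- A natural number congruent to x modulo d: -(n+1) ≡ (d - 1)(n + 1).
natRep : ℕ → ℤ → ℕ
natRep d (+ n)     = n
natRep d -[1+ n ] = (d ∸ 1) * suc n

natRep-+1 : ∀ e x → natRep (suc e) (x ℤ.+ + 1) % suc e ≡ (natRep (suc e) x + 1) % suc e
natRep-+1 e (+ n)           = refl
natRep-+1 e -[1+ zero ]    = trans (sym (n%n≡0 (suc e))) (cong (_% suc e) (e≡e*1+1 e))
  where
  e≡e*1+1 : ∀ e → suc e ≡ e * 1 + 1
  e≡e*1+1 = solve-∀
natRep-+1 e -[1+ suc n ]   =
  trans (sym ([m+kn]%n≡m%n (e * suc n) 1 (suc e))) (cong (_% suc e) (step e n))
  where
  step : ∀ e n → e * suc n + 1 * suc e ≡ e * suc (suc n) + 1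
  step = solve-∀

natRep-+ : ∀ e x k → natRep (suc e) (x ℤ.+ + k) % suc e ≡ (natRep (suc e) x + k) % suc e
natRep-+ e x zero    = trans (cong (λ y → natRep (suc e) y % suc e) (ℤ.+-identityʳ x))
                             (cong (_% suc e) (sym (ℕ.+-identityʳ (natRep (suc e) x))))
natRep-+ e x (suc k) = begin
  natRep d (x ℤ.+ + suc k) % d
    ≡⟨ cong (λ y → natRep d y % d) (ℤ.+-assoc x (+ 1) (+ k)) ⟨
  natRep d ((x ℤ.+ + 1) ℤ.+ + k) % d
    ≡⟨ natRep-+ e (x ℤ.+ + 1) k ⟩
  (natRep d (x ℤ.+ + 1) + k) % d
    ≡⟨ %-resp-+ d (natRep d (x ℤ.+ + 1)) (natRep d x + 1) k k (natRep-+1 e x) refl ⟩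
  (natRep d x + 1 + k) % d
    ≡⟨ cong (_% d) (ℕ.+-assoc (natRep d x) 1 k) ⟩
  (natRep d x + suc k) % d
    ∎
  where
  open ≡-Reasoning
  d = suc e

indivisibleBy3 : ℕ → Bool
indivisibleBy3 u = not (u % 3 ≡ᵇ 0)

indivisibleBy3-cong : ∀ m n → m % 3 ≡ n % 3 → indivisibleBy3 m ≡ indivisibleBy3 n
indivisibleBy3-cong _ _ = cong (λ r → not (r ≡ᵇ 0))

nonMultiplesOf3 : SubsetZ
nonMultiplesOf3 x = indivisibleBy3 (natRep 3 x)

nonMultiplesOf3-+ : ∀ x k → nonMultiplesOf3 (x ℤ.+ + k) ≡ indivisibleBy3 (natRep 3 x + k)
nonMultiplesOf3-+ x k =
  indivisibleBy3-cong (natRep 3 (x ℤ.+ + k)) (natRep 3 x + k) (natRep-+ 2 x k)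

residues-cover : ∀ r α → r < 3 → α < 3 → α ≢ 0 →
  indivisibleBy3 r ∧ indivisibleBy3 (r + α) ∧ indivisibleBy3 (r + (α + α)) ≡ false
residues-cover _ 0 _ _ α≢0 = ⊥-elim (α≢0 refl)
residues-cover 0 (suc _) _ _ _ = refl
residues-cover 1 1 _ _ _ = refl
residues-cover 1 2 _ _ _ = refl
residues-cover 2 1 _ _ _ = refl
residues-cover 2 2 _ _ _ = refl
residues-cover (suc (suc (suc _))) _ (s≤s (s≤s (s≤s ()))) _ _
residues-cover (suc _) (suc (suc (suc _))) _ (s≤s (s≤s (s≤s ()))) _

gap-hits-multipleOf3 : ∀ u a b → a % 3 ≡ b % 3 → a % 3 ≢ 0 →
  indivisibleBy3 u ∧ indivisibleBy3 (u + a) ∧ indivisibleBy3 (u + (a + b)) ≡ false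
gap-hits-multipleOf3 u a b a≡b 3∤a = begin
  indivisibleBy3 u ∧ indivisibleBy3 (u + a) ∧ indivisibleBy3 (u + (a + b))
    ≡⟨ cong₂ _∧_ (indivisibleBy3-cong u r u≡r)
         (cong₂ _∧_ (indivisibleBy3-cong (u + a) (r + α) u+a≡r+α)
                    (indivisibleBy3-cong (u + (a + b)) (r + (α + α)) u+a+b≡r+2α)) ⟩
  indivisibleBy3 r ∧ indivisibleBy3 (r + α) ∧ indivisibleBy3 (r + (α + α))
    ≡⟨ residues-cover r α (m%n<n u 3) (m%n<n a 3) 3∤a ⟩
  false ∎
  where
  open ≡-Reasoning
  r = u % 3
  α = a % 3
  u≡r : u % 3 ≡ r % 3
  u≡r = sym (m%n%n≡m%n u 3)
  a≡α : a % 3 ≡ α % 3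
  a≡α = sym (m%n%n≡m%n a 3)
  u+a≡r+α : (u + a) % 3 ≡ (r + α) % 3
  u+a≡r+α = %-resp-+ 3 u r a α u≡r a≡α
  u+a+b≡r+2α : (u + (a + b)) % 3 ≡ (r + (α + α)) % 3
  u+a+b≡r+2α =
    %-resp-+ 3 u r (a + b) (α + α) u≡r (%-resp-+ 3 a α b α a≡α (trans (sym a≡b) a≡α))

nonMultiplesOf3-free : ∀ a b → a % 3 ≡ b % 3 → a % 3 ≢ 0 →
                       Free (gapPattern a b) nonMultiplesOf3
nonMultiplesOf3-free a b a≡b 3∤a (t , h₀ ∷ h₁ ∷ h₂ ∷ []) = true≢false (begin
  true
    ≡⟨ all-true ⟨
  indivisibleBy3 u ∧ indivisibleBy3 (u + a) ∧ indivisibleBy3 (u + (a + b))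
    ≡⟨ gap-hits-multipleOf3 u a b a≡b 3∤a ⟩
  false
    ∎)
  where
  open ≡-Reasoning
  true≢false : true ≢ false
  true≢false ()
  u = natRep 3 t
  shifted : ∀ k → nonMultiplesOf3 (+ k ℤ.+ t) ≡ true → indivisibleBy3 (u + k) ≡ true
  shifted k h =
    trans (sym (nonMultiplesOf3-+ t k)) (trans (cong nonMultiplesOf3 (ℤ.+-comm t (+ k))) h)
  all-true : indivisibleBy3 u ∧ indivisibleBy3 (u + a) ∧ indivisibleBy3 (u + (a + b)) ≡ true
  all-true = cong₂ _∧_ (subst (λ x → nonMultiplesOf3 x ≡ true) (ℤ.+-identityˡ t) h₀)
                       (cong₂ _∧_ (shifted a h₁) (shifted (a + b) h₂))

-- -{0, a, a + b} is the translate of {0, b, b + a} by -(a + b).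
negS-gapPattern : ∀ a b A → ContainsTranslate A (negS (gapPattern a b)) →
                  ContainsTranslate A (gapPattern b a)
negS-gapPattern a b A (t , h₀ ∷ h₁ ∷ h₂ ∷ []) = t′ ,
  subst (λ x → A x ≡ true) (first (+ a) (+ b) t) h₂ ∷
  subst (λ x → A x ≡ true) (middle (+ a) (+ b) t) h₁ ∷
  subst (λ x → A x ≡ true) (last (+ a) (+ b) t) h₀ ∷ []
  where
  t′ = ℤ.- + (a + b) ℤ.+ t
  first : ∀ a b t → ℤ.- (a ℤ.+ b) ℤ.+ t ≡ ℤ.0ℤ ℤ.+ (ℤ.- (a ℤ.+ b) ℤ.+ t)
  first = ℤ-Solver.solve-∀
  middle : ∀ a b t → ℤ.- a ℤ.+ t ≡ b ℤ.+ (ℤ.- (a ℤ.+ b) ℤ.+ t)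
  middle = ℤ-Solver.solve-∀
  last : ∀ a b t → ℤ.0ℤ ℤ.+ t ≡ (b ℤ.+ a) ℤ.+ (ℤ.- (a ℤ.+ b) ℤ.+ t)
  last = ℤ-Solver.solve-∀

indivisibleBy3-periodic : ∀ r i → indivisibleBy3 (r + (3 + i)) ≡ indivisibleBy3 (r + i)
indivisibleBy3-periodic r i = indivisibleBy3-cong (r + (3 + i)) (r + i)
  (trans (cong (_% 3) (rearrange r i)) ([m+kn]%n≡m%n (r + i) 1 3))
  where
  rearrange : ∀ r i → r + (3 + i) ≡ r + i + 1 * 3
  rearrange = solve-∀

indivisibleBy3-period-sum : ∀ r → sumUpTo (λ i → indicator (indivisibleBy3 (r + i))) 3 ≡ 2
indivisibleBy3-period-sum r =
  trans (sumUpTo-cong 3 (λ i → cong indicator (indivisibleBy3-cong (r + i) (r % 3 + i)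
                          (%-resp-+ 3 r (r % 3) i i (sym (m%n%n≡m%n r 3)) refl))))
        (residue-sum (r % 3) (m%n<n r 3))
  where
  residue-sum : ∀ s → s < 3 → sumUpTo (λ i → indicator (indivisibleBy3 (s + i))) 3 ≡ 2
  residue-sum 0 _ = refl
  residue-sum 1 _ = refl
  residue-sum 2 _ = refl
  residue-sum (suc (suc (suc _))) (s≤s (s≤s (s≤s ())))

countIn-nonMultiplesOf3 : ∀ n k → suc (2 * n) ≡ k * 3 → countIn nonMultiplesOf3 n ≡ k * 2
countIn-nonMultiplesOf3 n k length≡k*3 = begin
  countIn nonMultiplesOf3 n
    ≡⟨ countIn≡sumUpTo nonMultiplesOf3 n ⟩
  sumUpTo (λ i → indicator (nonMultiplesOf3 (x ℤ.+ + i))) m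
    ≡⟨ sumUpTo-cong m (cong indicator ∘ nonMultiplesOf3-+ x) ⟩
  sumUpTo f m
    ≡⟨ cong (sumUpTo f) length≡k*3 ⟩
  sumUpTo f (k * 3)
    ≡⟨ sumUpTo-periodic f 3 (cong indicator ∘ indivisibleBy3-periodic r) k ⟩
  k * sumUpTo f 3
    ≡⟨ cong (k *_) (indivisibleBy3-period-sum r) ⟩
  k * 2
    ∎
  where
  open ≡-Reasoning
  m = suc (2 * n)
  x = ℤ.- + n
  r = natRep 3 x
  f : ℕ → ℕ
  f i = indicator (indivisibleBy3 (r + i))

-- Windows [-n, n] with n ≡ 1 (mod 3) have length divisible by 3.
nonMultiplesOf3-dense : ∀ N → ∃ λ n → N ≤ n × + 2 / 3 ℚ.≤ ratio nonMultiplesOf3 n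
nonMultiplesOf3-dense N = n , ℕ.m≤n⇒m≤1+n (ℕ.m≤m*n N 3) ,
  /-mono-cross 2 2 (countIn nonMultiplesOf3 n) (2 * n) (ℕ.≤-reflexive (begin
    2 * suc (2 * n)                  ≡⟨ cong (2 *_) length≡k*3 ⟩
    2 * (k * 3)                      ≡⟨ swap k ⟩
    k * 2 * 3                        ≡⟨ cong (_* 3) (countIn-nonMultiplesOf3 n k length≡k*3) ⟨
    countIn nonMultiplesOf3 n * 3    ∎))
  where
  open ≡-Reasoning
  n = suc (N * 3)
  k = suc (2 * N)
  length≡k*3 : suc (2 * n) ≡ k * 3
  length≡k*3 = window-length N
    where
    window-length : ∀ N → suc (2 * suc (N * 3)) ≡ suc (2 * N) * 3
    window-length = solve-∀
  swap : ∀ k → 2 * (k * 3) ≡ k * 2 * 3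
  swap = solve-∀

supDensity≡2/3 : ∀ a b (P : SubsetZ → Set) → (∀ A → P A → Free (gapPattern a b) A) →
                 P nonMultiplesOf3 → SupDensityIs P (+ 2 / 3)
supDensity≡2/3 a b P P⇒free P-nonMultiplesOf3 =
  (λ A PA → free⇒upperDensity≤2/3 a b A (P⇒free A PA)) ,
  (λ c c<2/3 → nonMultiplesOf3 , P-nonMultiplesOf3 , (+ 2 / 3 , c<2/3 , nonMultiplesOf3-dense))

coprime-≡%3⇒%3≢0 : ∀ a b → Coprime a b → a % 3 ≡ b % 3 → a % 3 ≢ 0
coprime-≡%3⇒%3≢0 a b coprime a≡b a%3≡0
  with coprime (m%n≡0⇒n∣m a 3 a%3≡0 , m%n≡0⇒n∣m b 3 (trans (sym a≡b) a%3≡0))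
... | ()

proposition1 : (λ₁ λ₂ : ℕ) → 0 < λ₁ → 0 < λ₂ → Coprime λ₁ λ₂ → λ₁ % 3 ≡ λ₂ % 3 →
    DfSymIs (+ 0 ∷ + λ₁ ∷ + (λ₁ + λ₂) ∷ []) ((+ 2) / 3)
    × DfIs (+ 0 ∷ + λ₁ ∷ + (λ₁ + λ₂) ∷ []) ((+ 2) / 3)
proposition1 λ₁ λ₂ _ _ coprime λ₁≡λ₂ =
  supDensity≡2/3 λ₁ λ₂ _ (λ _ → proj₁) (free , free-of-negS) ,
  supDensity≡2/3 λ₁ λ₂ _ (λ _ → id) free
  where
  3∤λ₁ : λ₁ % 3 ≢ 0
  3∤λ₁ = coprime-≡%3⇒%3≢0 λ₁ λ₂ coprime λ₁≡λ₂
  free : Free (gapPattern λ₁ λ₂) nonMultiplesOf3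
  free = nonMultiplesOf3-free λ₁ λ₂ λ₁≡λ₂ 3∤λ₁
  free-of-negS : Free (negS (gapPattern λ₁ λ₂)) nonMultiplesOf3
  free-of-negS = nonMultiplesOf3-free λ₂ λ₁ (sym λ₁≡λ₂) (3∤λ₁ ∘ trans λ₁≡λ₂)
                 ∘ negS-gapPattern λ₁ λ₂ nonMultiplesOf3
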